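{- Let $m,n\ge1$, let $B$ be the $m\times n$ board and let $G$ be a crosspatch knight pseudotour on $B$. Let $H$ be the graph whose vertices are all board vertices of $B$ and whose edges are the red board edges (defined below). Then every vertex of $H$ has degree $0$ or $2$.
   Context: Square $(i,j)$ of $B$ (column $i\in\{1,\dots,m\}$, row $j\in\{1,\dots,n\}$) is the unit square centred at the point $(i,j)$. Board vertices are the corners of these squares, i.e. the points $(a+\tfrac12,b+\tfrac12)$, $0\le a\le m$, $0\le b\le n$; board edges are the sides of these squares (unit segments between adjacent board vertices). A knight move is the segment joining the centres of two squares differing by $(\pm1,\pm2)$ or $(\pm2,\pm1)$. A knight pseudotour is a graph on the set of squares whose edges are knight moves and in which every vertex has degree $2$. Two knight moves form a cross if their midpoints coincide; $G$ is crosspatch if each of its edges forms a cross with another edge of $G$. For every cross formed by two edges of $G$, the board edge whose midpoint equals the common midpoint of the cross is coloured red. -}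

module Defs where

open import Data.Nat using (ℕ; suc; _+_; ∣_-_∣)
open import Data.Fin using (Fin; toℕ)
open import Data.Product using (_×_; Σ; ∃; ∃-syntax; _,_)
open import Data.Sum using (_⊎_)
open import Relation.Nullary using (¬_)
open import Relation.Binary.PropositionalEquality using (_≡_; _≢_)

-- Squares of the m × n board.  The square (i , j) with i : Fin m, j : Fin n
-- is the paper's square (toℕ i + 1 , toℕ j + 1), centred at that point.
Square : ℕ → ℕ → Set
Square m n = Fin m × Fin n

col : ∀ {m n} → Square m n → ℕ
col (i , _) = suc (toℕ i)

row : ∀ {m n} → Square m n → ℕ
row (_ , j) = suc (toℕ j)

KnightMove : ∀ {m n} → Square m n → Square m n → Set
KnightMove s t =
  (∣ col s - col t ∣ ≡ 1 × ∣ row s - row t ∣ ≡ 2)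
  ⊎ (∣ col s - col t ∣ ≡ 2 × ∣ row s - row t ∣ ≡ 1)

record Pseudotour (m n : ℕ) : Set₁ where
  field
    E      : Square m n → Square m n → Set
    E-sym  : ∀ {s t} → E s t → E t s
    E-knight : ∀ {s t} → E s t → KnightMove s t
    degree2 : ∀ s → ∃[ a ] ∃[ b ] (a ≢ b × E s a × E s b ×
                 (∀ c → E s c → c ≡ a ⊎ c ≡ b))
open Pseudotour public

-- Doubled coordinates of the midpoint of the segment between two square
-- centres: (col s + col t , row s + row t).
-- Two edges {p,q}, {p',q'} are distinct (as unordered pairs).
DistinctEdges : ∀ {m n} → (p q p' q' : Square m n) → Set
DistinctEdges p q p' q' = ¬ (p ≡ p' × q ≡ q') × ¬ (p ≡ q' × q ≡ p')

Cross : ∀ {m n} → Pseudotour m n → (p q p' q' : Square m n) → Set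
Cross G p q p' q' =
  E G p q × E G p' q' × DistinctEdges p q p' q' ×
  col p + col q ≡ col p' + col q' × row p + row q ≡ row p' + row q'

Crosspatch : ∀ {m n} → Pseudotour m n → Set
Crosspatch G = ∀ p q → E G p q → ∃[ p' ] ∃[ q' ] Cross G p q p' q'

-- Board vertices: (a , b) with a : Fin (m+1), b : Fin (n+1) is the point
-- (toℕ a + 1/2 , toℕ b + 1/2); in doubled coordinates (2a+1 , 2b+1).
BVertex : ℕ → ℕ → Set
BVertex m n = Fin (suc m) × Fin (suc n)

bx : ∀ {m n} → BVertex m n → ℕ
bx (a , _) = toℕ a

by : ∀ {m n} → BVertex m n → ℕ
by (_ , b) = toℕ b

BAdj : ∀ {m n} → BVertex m n → BVertex m n → Set
BAdj v w =
  ((suc (bx v) ≡ bx w ⊎ suc (bx w) ≡ bx v) × by v ≡ by w)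
  ⊎ ((suc (by v) ≡ by w ⊎ suc (by w) ≡ by v) × bx v ≡ bx w)

-- The board edge vw is red: its midpoint (doubled coordinates
-- (bx v + bx w + 1 , by v + by w + 1)) is the common midpoint of a cross of G.
Red : ∀ {m n} → Pseudotour m n → BVertex m n → BVertex m n → Set
Red G v w = BAdj v w ×
  ∃[ p ] ∃[ q ] ∃[ p' ] ∃[ q' ] (Cross G p q p' q' ×
     col p + col q ≡ bx v + bx w + 1 × row p + row q ≡ by v + by w + 1)

HDeg0 : ∀ {m n} → Pseudotour m n → BVertex m n → Set
HDeg0 G v = ∀ w → ¬ Red G v w

HDeg2 : ∀ {m n} → Pseudotour m n → BVertex m n → Set
HDeg2 G v = ∃[ a ] ∃[ b ] (a ≢ b × Red G v a × Red G v b ×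
              (∀ c → Red G v c → c ≡ a ⊎ c ≡ b))

-- Every knight move of G crosses exactly one other edge of G, and the two
-- crossing moves are the two diagonals of a 2×3 block of squares; the red
-- board edge sits at the centre of that block.  Each square has degree 2 and
-- its eight knight moves cross the eight board edges leaving its corners
-- outwards, so exactly two of those eight edges are red.  Sweeping the board
-- vertices from the lower-left corner, this count for the square below-left
-- of a vertex, together with the degrees of the three vertices already swept,
-- forces the degree of the new vertex to be even; the same count for the
-- square above-left of it rules out degree 4.
module Submission where

open import Defs
open import Data.Bool using (Bool; true; false; T; not; _∧_; _∨_)
open import Data.Bool.Properties using (T-∧)
open import Data.Empty using (⊥-elim)
open import Data.Fin as Fin using (Fin; toℕ; fromℕ<)
open import Data.Fin.Patterns using (0F; 1F; 2F; 3F; 4F; 5F; 6F; 7F)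
open import Data.Fin.Properties using (toℕ-injective; toℕ-fromℕ<; toℕ<n; toℕ≤pred[n]; all?)
open import Data.Nat
open import Data.Nat.Properties
open import Data.Nat.Tactic.RingSolver using (solve-∀)
open import Data.Product using (_×_; _,_; proj₁; proj₂; ∃-syntax; curry)
open import Data.Product.Properties using (≡-dec)
open import Data.Sum using (_⊎_; inj₁; inj₂; [_,_])
open import Data.Vec using (Vec; []; _∷_; _++_; lookup; tabulate; countᵇ)
open import Data.Vec.Properties using (tabulate∘lookup; tabulate-cong)
open import Function using (id; _∘_; _⇔_; Equivalence; mk⇔)
open import Relation.Binary.Definitions using (tri<; tri≈; tri>)
open import Relation.Nullary using (Dec; yes; no; ¬_; ¬?; _→-dec_)
open import Relation.Nullary.Decidable using (isYes; toWitness; fromWitness)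
open import Relation.Binary.PropositionalEquality hiding ([_])

-- Gaps and midpoints in ℕ

Gap : ℕ → ℕ → ℕ → Set
Gap p q d = q ≡ d + p ⊎ p ≡ d + q

∣-∣⇒Gap : ∀ {p q d} → ∣ p - q ∣ ≡ d → Gap p q d
∣-∣⇒Gap {zero}  {q}     refl = inj₁ (sym (+-identityʳ q))
∣-∣⇒Gap {suc p} {zero}  refl = inj₂ (sym (+-identityʳ (suc p)))
∣-∣⇒Gap {suc p} {suc q} e with ∣-∣⇒Gap {p} {q} e
... | inj₁ q≡d+p = inj₁ (trans (cong suc q≡d+p) (sym (+-suc _ p)))
... | inj₂ p≡d+q = inj₂ (trans (cong suc p≡d+q) (sym (+-suc _ q)))

twice-injective : ∀ d {p x} → p + (d + p) ≡ x + (d + x) → p ≡ x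
twice-injective d {p} {x} e with <-cmp p x
... | tri≈ _ p≡x _ = p≡x
... | tri< p<x _ _ = ⊥-elim (<⇒≢ (+-mono-< p<x (+-monoʳ-< d p<x)) e)
... | tri> _ _ x<p = ⊥-elim (<⇒≢ (+-mono-< x<p (+-monoʳ-< d x<p)) (sym e))

gap-midpoint : ∀ {p q d x} → Gap p q d → p + q ≡ x + (d + x) →
               (p ≡ x × q ≡ d + x) ⊎ (p ≡ d + x × q ≡ x)
gap-midpoint {d = d} (inj₁ refl) e = inj₁ (p≡x , cong (d +_) p≡x)
  where p≡x = twice-injective d e
gap-midpoint {q = q} {d} (inj₂ refl) e = inj₂ (cong (d +_) q≡x , q≡x)
  where q≡x = twice-injective d (trans (+-comm q (d + q)) e)

gap-sum : ∀ {p q d} → Gap p q d → ∃[ r ] p + q ≡ r + (d + r)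
gap-sum {p} (inj₁ refl) = p , refl
gap-sum {q = q} {d} (inj₂ refl) = q , +-comm (d + q) q

gap-sum≢0 : ∀ {p q d} → Gap p q (suc d) → p + q ≢ 0
gap-sum≢0 g e with gap-sum g
... | r , p+q≡ = m+1+n≢0 r (trans (sym p+q≡) e)

odd≢even : ∀ r x → r + (1 + r) ≢ x + (2 + x)
odd≢even r x e = even≢odd (suc x) r (trans (sym (even x)) (trans (sym e) (odd r)))
  where
  odd : ∀ r → r + (1 + r) ≡ suc (2 * r)
  odd = solve-∀
  even : ∀ x → x + (2 + x) ≡ 2 * suc x
  even = solve-∀

gap₁-sum≢even : ∀ {p q x} → Gap p q 1 → p + q ≢ x + (2 + x)
gap₁-sum≢even {x = x} g e with gap-sum g
... | r , p+q≡ = odd≢even r x (trans (sym p+q≡) e)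

gap₂-sum≢odd : ∀ {p q x} → Gap p q 2 → p + q ≢ x + (1 + x)
gap₂-sum≢odd {x = x} g e with gap-sum g
... | r , p+q≡ = odd≢even x r (trans (sym e) p+q≡)

shifted-sum : ∀ {p q c} → suc p + suc q ≡ 2 + c → p + q ≡ c
shifted-sum {p} {q} e = suc-injective (trans (sym (+-suc p q)) (suc-injective e))

suc-sum-injective : ∀ {p q p′ q′} → suc p + suc q ≡ suc p′ + suc q′ → p + q ≡ p′ + q′
suc-sum-injective {p′ = p′} {q′} e = shifted-sum (trans e (cong suc (+-suc p′ q′)))

n≢2+n : ∀ {k} → k ≢ 2 + k
n≢2+n {suc k} e = n≢2+n (suc-injective e)

suc+suc≢1 : ∀ {p q} → suc p + suc q ≢ 1
suc+suc≢1 {p} e = m+1+n≢0 p (suc-injective e)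

centre-sum : ∀ d x → suc x + (d + suc x) + 1 ≡ 2 + (x + (suc d + x))
centre-sum = solve-∀

-- Knight moves between lattice points

Point : Set
Point = ℕ × ℕ

Knight : Point → Point → Set
Knight (x , y) (x′ , y′) = (Gap x x′ 1 × Gap y y′ 2) ⊎ (Gap x x′ 2 × Gap y y′ 1)

knight-x-sum≢0 : ∀ {x y x′ y′} → Knight (x , y) (x′ , y′) → x + x′ ≢ 0
knight-x-sum≢0 (inj₁ (g , _)) = gap-sum≢0 g
knight-x-sum≢0 (inj₂ (g , _)) = gap-sum≢0 g

knight-y-sum≢0 : ∀ {x y x′ y′} → Knight (x , y) (x′ , y′) → y + y′ ≢ 0
knight-y-sum≢0 (inj₁ (_ , g)) = gap-sum≢0 g
knight-y-sum≢0 (inj₂ (_ , g)) = gap-sum≢0 g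

-- Move k crosses the midpoint of the
-- k-th board edge leaving a corner of the square outwards, in the order
-- NE corner (up, right), NW (up, left), SE (down, right), SW (down, left).
data Displaced : Fin 8 → Point → Point → Set where
  ne-up    : ∀ {x y} → Displaced 0F (x , y) (1 + x , 2 + y)
  ne-right : ∀ {x y} → Displaced 1F (x , y) (2 + x , 1 + y)
  nw-up    : ∀ {x y} → Displaced 2F (1 + x , y) (x , 2 + y)
  nw-left  : ∀ {x y} → Displaced 3F (2 + x , y) (x , 1 + y)
  se-down  : ∀ {x y} → Displaced 4F (x , 2 + y) (1 + x , y)
  se-right : ∀ {x y} → Displaced 5F (x , 1 + y) (2 + x , y)
  sw-down  : ∀ {x y} → Displaced 6F (1 + x , 2 + y) (x , y)
  sw-left  : ∀ {x y} → Displaced 7F (2 + x , 1 + y) (x , y)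

knight-direction : ∀ {a b} → Knight a b → ∃[ k ] Displaced k a b
knight-direction {_ , _} {_ , _} (inj₁ (inj₁ refl , inj₁ refl)) = 0F , ne-up
knight-direction {_ , _} {_ , _} (inj₂ (inj₁ refl , inj₁ refl)) = 1F , ne-right
knight-direction {_ , _} {_ , _} (inj₁ (inj₂ refl , inj₁ refl)) = 2F , nw-up
knight-direction {_ , _} {_ , _} (inj₂ (inj₂ refl , inj₁ refl)) = 3F , nw-left
knight-direction {_ , _} {_ , _} (inj₁ (inj₁ refl , inj₂ refl)) = 4F , se-down
knight-direction {_ , _} {_ , _} (inj₂ (inj₁ refl , inj₂ refl)) = 5F , se-right
knight-direction {_ , _} {_ , _} (inj₁ (inj₂ refl , inj₂ refl)) = 6F , sw-down
knight-direction {_ , _} {_ , _} (inj₂ (inj₂ refl , inj₂ refl)) = 7F , sw-left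

displaced-target-unique : ∀ {k a b b′} → Displaced k a b → Displaced k a b′ → b ≡ b′
displaced-target-unique ne-up    ne-up    = refl
displaced-target-unique ne-right ne-right = refl
displaced-target-unique nw-up    nw-up    = refl
displaced-target-unique nw-left  nw-left  = refl
displaced-target-unique se-down  se-down  = refl
displaced-target-unique se-right se-right = refl
displaced-target-unique sw-down  sw-down  = refl
displaced-target-unique sw-left  sw-left  = refl

displaced-direction-unique : ∀ {k k′ a b} → Displaced k a b → Displaced k′ a b → k ≡ k′
displaced-direction-unique ne-up    ne-up    = refl
displaced-direction-unique ne-right ne-right = refl
displaced-direction-unique nw-up    nw-up    = refl
displaced-direction-unique nw-left  nw-left  = refl
displaced-direction-unique se-down  se-down  = refl
displaced-direction-unique se-right se-right = refl
displaced-direction-unique sw-down  sw-down  = refl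
displaced-direction-unique sw-left  sw-left  = refl

-- A block of shape σ is the (1 + width σ) × (1 + height σ) rectangle of
-- squares with lower-left square (x , y); its diagonals are knight moves, and
-- Across σ x y a b says that the segment ab has the same midpoint.
data Shape : Set where
  steep flat : Shape

width height : Shape → ℕ
width steep  = 1
width flat   = 2
height steep = 2
height flat  = 1

Across : Shape → ℕ → ℕ → Point → Point → Set
Across σ x y (a₁ , a₂) (b₁ , b₂) = a₁ + b₁ ≡ x + (width σ + x) × a₂ + b₂ ≡ y + (height σ + y)

Joins : Point → Point → Point → Point → Set
Joins a b c d = (a ≡ c × b ≡ d) ⊎ (a ≡ d × b ≡ c)

gaps-across : ∀ {a₁ a₂ b₁ b₂ w h x y} → Gap a₁ b₁ w → Gap a₂ b₂ h →
  a₁ + b₁ ≡ x + (w + x) → a₂ + b₂ ≡ y + (h + y) →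
  Joins (a₁ , a₂) (b₁ , b₂) (x , y) (w + x , h + y) ⊎ Joins (a₁ , a₂) (b₁ , b₂) (w + x , y) (x , h + y)
gaps-across {x = x} {y} gx gy ex ey with gap-midpoint {x = x} gx ex | gap-midpoint {x = y} gy ey
... | inj₁ (refl , refl) | inj₁ (refl , refl) = inj₁ (inj₁ (refl , refl))
... | inj₂ (refl , refl) | inj₂ (refl , refl) = inj₁ (inj₂ (refl , refl))
... | inj₂ (refl , refl) | inj₁ (refl , refl) = inj₂ (inj₁ (refl , refl))
... | inj₁ (refl , refl) | inj₂ (refl , refl) = inj₂ (inj₂ (refl , refl))

knight-across : ∀ {σ x y a b} → Knight a b → Across σ x y a b →
  Joins a b (x , y) (width σ + x , height σ + y) ⊎ Joins a b (width σ + x , y) (x , height σ + y)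
knight-across {steep} {a = _ , _} {_ , _} (inj₁ (gx , gy)) (ex , ey) = gaps-across gx gy ex ey
knight-across {steep} {a = _ , _} {_ , _} (inj₂ (gx , _))  (ex , _)  = ⊥-elim (gap₂-sum≢odd gx ex)
knight-across {flat}  {a = _ , _} {_ , _} (inj₂ (gx , gy)) (ex , ey) = gaps-across gx gy ex ey
knight-across {flat}  {a = _ , _} {_ , _} (inj₁ (gx , _))  (ex , _)  = ⊥-elim (gap₁-sum≢even gx ex)

-- Boolean bookkeeping and the local degree step

T-ext : ∀ {a b} → (T a → T b) → (T b → T a) → a ≡ b
T-ext {false} {false} _ _ = refl
T-ext {false} {true}  _ g = ⊥-elim (g _)
T-ext {true}  {false} f _ = ⊥-elim (f _)
T-ext {true}  {true}  _ _ = refl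

T-not-∨ : ∀ {p q} → T (not p ∨ q) ⇔ (T p → T q)
T-not-∨ {true}  = mk⇔ (λ t _ → t) (λ f → f _)
T-not-∨ {false} = mk⇔ (λ _ ()) (λ _ → _)

allVecs : ∀ k → (Vec Bool k → Bool) → Bool
allVecs zero    f = f []
allVecs (suc k) f = allVecs k (f ∘ (true ∷_)) ∧ allVecs k (f ∘ (false ∷_))

allVecs-sound : ∀ k (f : Vec Bool k → Bool) → T (allVecs k f) → ∀ bs → T (f bs)
allVecs-sound zero    f h []           = h
allVecs-sound (suc k) f h (true ∷ bs)  = allVecs-sound k _ (proj₁ (Equivalence.to T-∧ h)) bs
allVecs-sound (suc k) f h (false ∷ bs) = allVecs-sound k _ (proj₂ (Equivalence.to T-∧ h)) bs

countᵇ-++ʳ : ∀ {k l} (xs : Vec Bool k) (ys : Vec Bool l) → countᵇ id ys ≤ countᵇ id (xs ++ ys)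
countᵇ-++ʳ []           ys = ≤-refl
countᵇ-++ʳ (true ∷ xs)  ys = m≤n⇒m≤1+n (countᵇ-++ʳ xs ys)
countᵇ-++ʳ (false ∷ xs) ys = countᵇ-++ʳ xs ys

pair-count : ∀ {p q : Fin 8} → p ≢ q →
  countᵇ id (tabulate (λ k → isYes (k Fin.≟ p) ∨ isYes (k Fin.≟ q))) ≡ 2
pair-count {p} {q} = toWitness {a? = all? λ p → all? λ q →
  ¬? (p Fin.≟ q) →-dec (countᵇ id (tabulate (λ k → isYes (k Fin.≟ p) ∨ isYes (k Fin.≟ q))) ≟ 2)} _ p q

T-≟-pair : ∀ {k} {p q i : Fin k} → T (isYes (i Fin.≟ p) ∨ isYes (i Fin.≟ q)) ⇔ (i ≡ p ⊎ i ≡ q)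
T-≟-pair {p = p} {q} {i} with i Fin.≟ p | i Fin.≟ q
... | yes i≡p | _       = mk⇔ (λ _ → inj₁ i≡p) (λ _ → _)
... | no _    | yes i≡q = mk⇔ (λ _ → inj₂ i≡q) (λ _ → _)
... | no i≢p  | no i≢q  = mk⇔ (λ ()) [ i≢p , i≢q ]

zeroOrTwo : ℕ → Bool
zeroOrTwo k = (k ≡ᵇ 0) ∨ (k ≡ᵇ 2)

ZeroOrTwo : ℕ → Set
ZeroOrTwo = T ∘ zeroOrTwo

degree-step : Vec Bool 12 → Bool
degree-step (U ∷ D ∷ L ∷ R ∷ Ul ∷ Dl ∷ Ll ∷ Dd ∷ Ld ∷ Rd ∷ Dc ∷ Lc ∷ []) =
  not ((countᵇ id (U ∷ R ∷ Ul ∷ Ll ∷ Dd ∷ Rd ∷ Dc ∷ Lc ∷ []) ≡ᵇ 2)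
       ∧ (not R ∨ (countᵇ id (D ∷ R ∷ Dl ∷ Ll ∷ []) ≤ᵇ 2))
       ∧ zeroOrTwo (countᵇ id (Ul ∷ Dl ∷ Ll ∷ L ∷ []))
       ∧ zeroOrTwo (countᵇ id (D ∷ Dd ∷ Ld ∷ Rd ∷ []))
       ∧ zeroOrTwo (countᵇ id (Dl ∷ Dc ∷ Lc ∷ Ld ∷ [])))
  ∨ zeroOrTwo (countᵇ id (U ∷ D ∷ L ∷ R ∷ []))

-- U, D, L, R are the four edges at a vertex; Ul, Dl, Ll the others at its left
-- neighbour, Dd, Ld, Rd at its lower one and Dc, Lc at its lower-left one.
-- Summing the three known degrees, Dl and Ld count twice and the rest is the
-- first count minus U and R, so U + D + L + R is even.  Degree 4 would force
-- Dl and Ld, and then the second count would be 3.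
vertex-step : ∀ U D L R Ul Dl Ll Dd Ld Rd Dc Lc →
  countᵇ id (U ∷ R ∷ Ul ∷ Ll ∷ Dd ∷ Rd ∷ Dc ∷ Lc ∷ []) ≡ 2 →
  (T R → countᵇ id (D ∷ R ∷ Dl ∷ Ll ∷ []) ≤ 2) →
  ZeroOrTwo (countᵇ id (Ul ∷ Dl ∷ Ll ∷ L ∷ [])) →
  ZeroOrTwo (countᵇ id (D ∷ Dd ∷ Ld ∷ Rd ∷ [])) →
  ZeroOrTwo (countᵇ id (Dl ∷ Dc ∷ Lc ∷ Ld ∷ [])) →
  ZeroOrTwo (countᵇ id (U ∷ D ∷ L ∷ R ∷ []))
vertex-step U D L R Ul Dl Ll Dd Ld Rd Dc Lc square upper left lower lower-left =
  Equivalence.to T-not-∨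
    (allVecs-sound 12 degree-step _ (U ∷ D ∷ L ∷ R ∷ Ul ∷ Dl ∷ Ll ∷ Dd ∷ Ld ∷ Rd ∷ Dc ∷ Lc ∷ []))
    (both (≡⇒≡ᵇ _ 2 square)
      (both (Equivalence.from T-not-∨ (≤⇒≤ᵇ ∘ upper)) (both left (both lower lower-left))))
  where
  both : ∀ {p q} → T p → T q → T (p ∧ q)
  both = curry (Equivalence.from T-∧)

-- Board vertices

data Side : Set where
  up down left right : Side

select : {A : Set} → A → A → A → A → Side → A
select u _ _ _ up    = u
select _ d _ _ down  = d
select _ _ l _ left  = l
select _ _ _ r right = r

data ZeroOrTwoSides (f : Side → Bool) : Set where
  none : (∀ d → ¬ T (f d)) → ZeroOrTwoSides f
  two  : ∀ d₁ d₂ → d₁ ≢ d₂ → T (f d₁) → T (f d₂) →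
         (∀ d → T (f d) → d ≡ d₁ ⊎ d ≡ d₂) → ZeroOrTwoSides f

zero-or-two-sides : ∀ u d l r → ZeroOrTwo (countᵇ id (u ∷ d ∷ l ∷ r ∷ [])) →
                    ZeroOrTwoSides (select u d l r)
zero-or-two-sides false false false false _ = none λ { up () ; down () ; left () ; right () }
zero-or-two-sides true  true  false false _ =
  two up down (λ ()) _ _ λ { up _ → inj₁ refl ; down _ → inj₂ refl ; left () ; right () }
zero-or-two-sides true  false true  false _ =
  two up left (λ ()) _ _ λ { up _ → inj₁ refl ; down () ; left _ → inj₂ refl ; right () }
zero-or-two-sides true  false false true  _ =
  two up right (λ ()) _ _ λ { up _ → inj₁ refl ; down () ; left () ; right _ → inj₂ refl }
zero-or-two-sides false true  true  false _ =
  two down left (λ ()) _ _ λ { up () ; down _ → inj₁ refl ; left _ → inj₂ refl ; right () }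
zero-or-two-sides false true  false true  _ =
  two down right (λ ()) _ _ λ { up () ; down _ → inj₁ refl ; left () ; right _ → inj₂ refl }
zero-or-two-sides false false true  true  _ =
  two left right (λ ()) _ _ λ { up () ; down () ; left _ → inj₁ refl ; right _ → inj₂ refl }
zero-or-two-sides true  false false false ()
zero-or-two-sides false true  false false ()
zero-or-two-sides false false true  false ()
zero-or-two-sides false false false true  ()
zero-or-two-sides false true  true  true  ()
zero-or-two-sides true  false true  true  ()
zero-or-two-sides true  true  false true  ()
zero-or-two-sides true  true  true  false ()
zero-or-two-sides true  true  true  true  ()

module _ {m n : ℕ} where

  Neighbour : Side → BVertex m n → BVertex m n → Set
  Neighbour up    v w = bx w ≡ bx v × by w ≡ suc (by v)
  Neighbour down  v w = Neighbour up w v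
  Neighbour right v w = bx w ≡ suc (bx v) × by w ≡ by v
  Neighbour left  v w = Neighbour right w v

  bvertex-ext : ∀ {v w : BVertex m n} → bx v ≡ bx w → by v ≡ by w → v ≡ w
  bvertex-ext {_ , _} {_ , _} p q = cong₂ _,_ (toℕ-injective p) (toℕ-injective q)

  vertex-at : ∀ {a b} → a ≤ m → b ≤ n → ∃[ w ] (bx {m} {n} w ≡ a × by w ≡ b)
  vertex-at a≤m b≤n = (fromℕ< (s≤s a≤m) , fromℕ< (s≤s b≤n)) , toℕ-fromℕ< _ , toℕ-fromℕ< _

  bx≤m : (v : BVertex m n) → bx v ≤ m
  bx≤m v = toℕ≤pred[n] (proj₁ v)

  by≤n : (v : BVertex m n) → by v ≤ n
  by≤n v = toℕ≤pred[n] (proj₂ v)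

  adjacent-sym : ∀ {v w : BVertex m n} → BAdj v w → BAdj w v
  adjacent-sym (inj₁ (inj₁ e , f)) = inj₁ (inj₂ e , sym f)
  adjacent-sym (inj₁ (inj₂ e , f)) = inj₁ (inj₁ e , sym f)
  adjacent-sym (inj₂ (inj₁ e , f)) = inj₂ (inj₂ e , sym f)
  adjacent-sym (inj₂ (inj₂ e , f)) = inj₂ (inj₁ e , sym f)

  adjacent⇒neighbour : ∀ {v w : BVertex m n} → BAdj v w → ∃[ d ] Neighbour d v w
  adjacent⇒neighbour (inj₁ (inj₁ e , f)) = right , sym e , sym f
  adjacent⇒neighbour (inj₁ (inj₂ e , f)) = left  , sym e , f
  adjacent⇒neighbour (inj₂ (inj₁ e , f)) = up    , sym f , sym e
  adjacent⇒neighbour (inj₂ (inj₂ e , f)) = down  , f , sym e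

  neighbour⇒adjacent : ∀ {d} {v w : BVertex m n} → Neighbour d v w → BAdj v w
  neighbour⇒adjacent {up}    (e , f) = inj₂ (inj₁ (sym f) , sym e)
  neighbour⇒adjacent {down}  (e , f) = inj₂ (inj₂ (sym f) , e)
  neighbour⇒adjacent {right} (e , f) = inj₁ (inj₁ (sym e) , sym f)
  neighbour⇒adjacent {left}  (e , f) = inj₁ (inj₂ (sym e) , f)

  neighbour-unique : ∀ {d} {v w w′ : BVertex m n} → Neighbour d v w → Neighbour d v w′ → w ≡ w′
  neighbour-unique {up}    (e , f) (e′ , f′) = bvertex-ext (trans e (sym e′)) (trans f (sym f′))
  neighbour-unique {down}  (e , f) (e′ , f′) = bvertex-ext (trans (sym e) e′) (suc-injective (trans (sym f) f′))
  neighbour-unique {right} (e , f) (e′ , f′) = bvertex-ext (trans e (sym e′)) (trans f (sym f′))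
  neighbour-unique {left}  (e , f) (e′ , f′) = bvertex-ext (suc-injective (trans (sym e) e′)) (trans (sym f) f′)

  neighbour-side-unique : ∀ {d d′} {v w : BVertex m n} → Neighbour d v w → Neighbour d′ v w → d ≡ d′
  neighbour-side-unique {up}    {up}    _ _ = refl
  neighbour-side-unique {down}  {down}  _ _ = refl
  neighbour-side-unique {left}  {left}  _ _ = refl
  neighbour-side-unique {right} {right} _ _ = refl
  neighbour-side-unique {up}    {down}  (_ , f) (_ , f′) = ⊥-elim (n≢2+n (trans f′ (cong suc f)))
  neighbour-side-unique {down}  {up}    (_ , f) (_ , f′) = ⊥-elim (n≢2+n (trans f (cong suc f′)))
  neighbour-side-unique {up}    {right} (e , _) (e′ , _) = ⊥-elim (1+n≢n (trans (sym e′) e))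
  neighbour-side-unique {right} {up}    (e , _) (e′ , _) = ⊥-elim (1+n≢n (trans (sym e) e′))
  neighbour-side-unique {up}    {left}  (e , _) (e′ , _) = ⊥-elim (1+n≢n (trans (sym e′) (sym e)))
  neighbour-side-unique {left}  {up}    (e , _) (e′ , _) = ⊥-elim (1+n≢n (trans (sym e) (sym e′)))
  neighbour-side-unique {down}  {right} (e , _) (e′ , _) = ⊥-elim (1+n≢n (trans (sym e′) (sym e)))
  neighbour-side-unique {right} {down}  (e , _) (e′ , _) = ⊥-elim (1+n≢n (trans (sym e) (sym e′)))
  neighbour-side-unique {down}  {left}  (e , _) (e′ , _) = ⊥-elim (1+n≢n (trans (sym e′) e))
  neighbour-side-unique {left}  {down}  (e , _) (e′ , _) = ⊥-elim (1+n≢n (trans (sym e) e′))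
  neighbour-side-unique {left}  {right} (e , _) (e′ , _) = ⊥-elim (n≢2+n (trans e (cong suc e′)))
  neighbour-side-unique {right} {left}  (e , _) (e′ , _) = ⊥-elim (n≢2+n (trans e′ (cong suc e)))

module Geometry {m n : ℕ} (G : Pseudotour m n) where

  pos : Square m n → Point
  pos s = toℕ (proj₁ s) , toℕ (proj₂ s)

  pos-injective : ∀ {s t} → pos s ≡ pos t → s ≡ t
  pos-injective {_ , _} {_ , _} e =
    cong₂ _,_ (toℕ-injective (cong proj₁ e)) (toℕ-injective (cong proj₂ e))

  same-pos : ∀ {s t c} → pos s ≡ c → pos t ≡ c → s ≡ t
  same-pos ps pt = pos-injective (trans ps (sym pt))

  Edge : Point → Point → Set
  Edge a b = ∃[ s ] ∃[ t ] (E G s t × pos s ≡ a × pos t ≡ b)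

  edge-sym : ∀ {a b} → Edge a b → Edge b a
  edge-sym (s , t , e , ps , pt) = t , s , E-sym G e , pt , ps

  E? : (s t : Square m n) → Dec (E G s t)
  E? s t with degree2 G s
  ... | a , b , _ , sa , sb , only with ≡-dec Fin._≟_ Fin._≟_ t a | ≡-dec Fin._≟_ Fin._≟_ t b
  ... | yes refl | _        = yes sa
  ... | no _     | yes refl = yes sb
  ... | no t≢a   | no t≢b   = no λ e → [ t≢a , t≢b ] (only t e)

  square? : (a : Point) → Dec (∃[ s ] pos s ≡ a)
  square? (x , y) with x <? m | y <? n
  ... | yes x<m | yes y<n =
    yes ((fromℕ< x<m , fromℕ< y<n) , cong₂ _,_ (toℕ-fromℕ< x<m) (toℕ-fromℕ< y<n))
  ... | no x≮m | _ = no λ (s , e) → x≮m (subst (_< m) (cong proj₁ e) (toℕ<n (proj₁ s)))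
  ... | _ | no y≮n = no λ (s , e) → y≮n (subst (_< n) (cong proj₂ e) (toℕ<n (proj₂ s)))

  edge? : (a b : Point) → Dec (Edge a b)
  edge? a b with square? a | square? b
  ... | no ∄s | _ = no λ (s , _ , _ , ps , _) → ∄s (s , ps)
  ... | _ | no ∄t = no λ (_ , t , _ , _ , pt) → ∄t (t , pt)
  ... | yes (s , ps) | yes (t , pt) with E? s t
  ...   | yes e = yes (s , t , e , ps , pt)
  ...   | no ¬e = no λ (s′ , t′ , e′ , ps′ , pt′) →
                     ¬e (subst₂ (E G) (same-pos ps′ ps) (same-pos pt′ pt) e′)

  knight : ∀ {s t} → E G s t → Knight (pos s) (pos t)
  knight e with E-knight G e
  ... | inj₁ (dx , dy) = inj₁ (∣-∣⇒Gap dx , ∣-∣⇒Gap dy)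
  ... | inj₂ (dx , dy) = inj₂ (∣-∣⇒Gap dx , ∣-∣⇒Gap dy)

  direction : ∀ {a b} → Edge a b → ∃[ k ] Displaced k a b
  direction (_ , _ , e , refl , refl) = knight-direction (knight e)

  joins-edge : ∀ {s t c d} → E G s t → Joins (pos s) (pos t) c d → Edge c d
  joins-edge e (inj₁ (ps , pt)) = _ , _ , e , ps , pt
  joins-edge e (inj₂ (ps , pt)) = _ , _ , E-sym G e , pt , ps

  joins-same-edge : ∀ {s t p q c d} → Joins (pos s) (pos t) c d → Joins (pos p) (pos q) c d →
                    ¬ DistinctEdges s t p q
  joins-same-edge (inj₁ (sc , td)) (inj₁ (pc , qd)) (≢same , _) = ≢same (same-pos sc pc , same-pos td qd)
  joins-same-edge (inj₁ (sc , td)) (inj₂ (pd , qc)) (_ , ≢swap) = ≢swap (same-pos sc qc , same-pos td pd)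
  joins-same-edge (inj₂ (sd , tc)) (inj₁ (pc , qd)) (_ , ≢swap) = ≢swap (same-pos sd qd , same-pos tc pc)
  joins-same-edge (inj₂ (sd , tc)) (inj₂ (pd , qc)) (≢same , _) = ≢same (same-pos sd pd , same-pos tc qc)

  Diagonal AntiDiagonal : Shape → ℕ → ℕ → Set
  Diagonal     σ x y = Edge (x , y) (width σ + x , height σ + y)
  AntiDiagonal σ x y = Edge (width σ + x , y) (x , height σ + y)

  diagonal? : Shape → ℕ → ℕ → Bool
  diagonal? σ x y = isYes (edge? (x , y) (width σ + x , height σ + y))

  diagonal-sound : ∀ σ {x y} → T (diagonal? σ x y) → Diagonal σ x y
  diagonal-sound σ {x} {y} = toWitness {a? = edge? (x , y) (width σ + x , height σ + y)}

  diagonal-complete : ∀ σ {x y} → Diagonal σ x y → T (diagonal? σ x y)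
  diagonal-complete _ = fromWitness

  diagonal-bounds : ∀ σ {x y} → Diagonal σ x y → width σ + x < m × height σ + y < n
  diagonal-bounds _ (_ , t , _ , _ , pt) =
    subst (_< m) (cong proj₁ pt) (toℕ<n (proj₁ t)) , subst (_< n) (cong proj₂ pt) (toℕ<n (proj₂ t))

  Through : ℕ → ℕ → Set
  Through c₁ c₂ = ∃[ s ] ∃[ t ] (E G s t × col s + col t ≡ c₁ × row s + row t ≡ c₂)

  through-subst : ∀ {a b c c′ d d′} → c ≡ c′ → d ≡ d′ →
                  Through (a + c + 1) (b + d + 1) → Through (a + c′ + 1) (b + d′ + 1)
  through-subst refl refl t = t

  diagonal-through : ∀ σ {x y} → Diagonal σ x y →
                     Through (2 + (x + (width σ + x))) (2 + (y + (height σ + y)))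
  diagonal-through _ (s , t , e , ps , pt) =
    s , t , e , centres (cong proj₁ ps) (cong proj₁ pt) , centres (cong proj₂ ps) (cong proj₂ pt)
    where
    centres : ∀ {p q c d} → p ≡ c → q ≡ d → suc p + suc q ≡ 2 + (c + d)
    centres {p} {q} refl refl = cong suc (+-suc p q)

  -- upRed a b: the board edge from vertex (a , b) up to (a , 1 + b) is red.
  -- The knight moves through its midpoint are the diagonals of the steep block
  -- with lower-left square (a - 1 , b - 1); likewise rightRed and flat blocks.
  upRed rightRed downRed leftRed : ℕ → ℕ → Bool
  upRed (suc x) (suc y) = diagonal? steep x y
  upRed _       _       = false
  rightRed (suc x) (suc y) = diagonal? flat x y
  rightRed _       _       = false
  downRed _ zero    = false
  downRed a (suc b) = upRed a b
  leftRed zero    _ = false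
  leftRed (suc a) b = rightRed a b

  downRed-positive : ∀ {a} b → T (downRed a b) → ∃[ b′ ] b ≡ suc b′
  downRed-positive zero    ()
  downRed-positive (suc b) _ = b , refl

  leftRed-positive : ∀ a {b} → T (leftRed a b) → ∃[ a′ ] a ≡ suc a′
  leftRed-positive zero    ()
  leftRed-positive (suc a) _ = a , refl

  redSides : ℕ → ℕ → Side → Bool
  redSides a b = select (upRed a b) (downRed a b) (leftRed a b) (rightRed a b)

  sideCount : ℕ → ℕ → ℕ
  sideCount a b = countᵇ id (upRed a b ∷ downRed a b ∷ leftRed a b ∷ rightRed a b ∷ [])

  upperOutwardRed lowerOutwardRed : ℕ → ℕ → Vec Bool 4
  upperOutwardRed x y = upRed (suc x) (suc y) ∷ rightRed (suc x) (suc y) ∷ upRed x (suc y) ∷ leftRed x (suc y) ∷ []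
  lowerOutwardRed x y = downRed (suc x) y ∷ rightRed (suc x) y ∷ downRed x y ∷ leftRed x y ∷ []

  outwardRed : ℕ → ℕ → Vec Bool 8
  outwardRed x y = upperOutwardRed x y ++ lowerOutwardRed x y

  upRed⇒through : ∀ a b → T (upRed a b) → Through (a + a + 1) (b + (1 + b) + 1) × suc b ≤ n
  upRed⇒through (suc x) (suc y) r =
    subst₂ Through (sym (centre-sum 0 x)) (sym (centre-sum 1 y)) (diagonal-through steep d) ,
    <⇒≤ (proj₂ (diagonal-bounds steep d))
    where d = diagonal-sound steep r

  rightRed⇒through : ∀ a b → T (rightRed a b) → Through (a + (1 + a) + 1) (b + b + 1) × suc a ≤ m
  rightRed⇒through (suc x) (suc y) r =
    subst₂ Through (sym (centre-sum 1 x)) (sym (centre-sum 0 y)) (diagonal-through flat d) ,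
    <⇒≤ (proj₁ (diagonal-bounds flat d))
    where d = diagonal-sound flat r

  module Crosspatched (crosspatch : Crosspatch G) where

    -- Crosspatch supplies a second, distinct move with the same midpoint; both
    -- moves are diagonals of the block, so they are its two different diagonals.
    both-diagonals : ∀ σ {x y a b} → Edge a b → Across σ x y a b → Diagonal σ x y × AntiDiagonal σ x y
    both-diagonals _ (s , t , e , refl , refl) (ex , ey) with crosspatch s t e
    ... | p , q , _ , e′ , distinct , cols , rows
      with knight-across (knight e) (ex , ey)
         | knight-across (knight e′) (trans (sym (suc-sum-injective cols)) ex , trans (sym (suc-sum-injective rows)) ey)
    ... | inj₁ main | inj₂ anti = joins-edge e main , joins-edge e′ anti
    ... | inj₂ anti | inj₁ main = joins-edge e′ main , joins-edge e anti
    ... | inj₁ j    | inj₁ j′   = ⊥-elim (joins-same-edge j j′ distinct)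
    ... | inj₂ j    | inj₂ j′   = ⊥-elim (joins-same-edge j j′ distinct)

    diagonal⇒anti : ∀ σ {x y} → Diagonal σ x y → AntiDiagonal σ x y
    diagonal⇒anti σ d = proj₂ (both-diagonals σ d (refl , refl))

    anti⇒diagonal : ∀ σ {x y} → AntiDiagonal σ x y → Diagonal σ x y
    anti⇒diagonal σ {x} d = proj₁ (both-diagonals σ d (+-comm (width σ + x) x , refl))

    through⇒upRed : ∀ a b → Through (a + a + 1) (b + (1 + b) + 1) → T (upRed a b)
    through⇒upRed zero    b       (_ , _ , _ , cols , _)    = ⊥-elim (suc+suc≢1 cols)
    through⇒upRed (suc x) zero    (_ , _ , e , _ , rows)    = ⊥-elim (knight-y-sum≢0 (knight e) (shifted-sum rows))
    through⇒upRed (suc x) (suc y) (s , t , e , cols , rows) =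
      diagonal-complete steep (proj₁ (both-diagonals steep (s , t , e , refl , refl) across))
      where across = shifted-sum (trans cols (centre-sum 0 x)) , shifted-sum (trans rows (centre-sum 1 y))

    through⇒rightRed : ∀ a b → Through (a + (1 + a) + 1) (b + b + 1) → T (rightRed a b)
    through⇒rightRed zero    b       (_ , _ , e , cols , _)    = ⊥-elim (knight-x-sum≢0 (knight e) (shifted-sum cols))
    through⇒rightRed (suc x) zero    (_ , _ , _ , _ , rows)    = ⊥-elim (suc+suc≢1 rows)
    through⇒rightRed (suc x) (suc y) (s , t , e , cols , rows) =
      diagonal-complete flat (proj₁ (both-diagonals flat (s , t , e , refl , refl) across))
      where across = shifted-sum (trans cols (centre-sum 1 x)) , shifted-sum (trans rows (centre-sum 0 y))

    outwardRed⇒edge : ∀ x y k → T (lookup (outwardRed x y) k) →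
                      ∃[ b ] (Edge (x , y) b × Displaced k (x , y) b)
    outwardRed⇒edge x             y             0F r = _ , diagonal-sound steep r , ne-up
    outwardRed⇒edge x             y             1F r = _ , diagonal-sound flat r , ne-right
    outwardRed⇒edge (suc x)       y             2F r = _ , diagonal⇒anti steep (diagonal-sound steep r) , nw-up
    outwardRed⇒edge (suc (suc x)) y             3F r = _ , diagonal⇒anti flat (diagonal-sound flat r) , nw-left
    outwardRed⇒edge x             (suc (suc y)) 4F r =
      _ , edge-sym (diagonal⇒anti steep (diagonal-sound steep r)) , se-down
    outwardRed⇒edge x             (suc y)       5F r =
      _ , edge-sym (diagonal⇒anti flat (diagonal-sound flat r)) , se-right
    outwardRed⇒edge (suc x)       (suc (suc y)) 6F r = _ , edge-sym (diagonal-sound steep r) , sw-down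
    outwardRed⇒edge (suc (suc x)) (suc y)       7F r = _ , edge-sym (diagonal-sound flat r) , sw-left
    outwardRed⇒edge zero          zero          6F ()
    outwardRed⇒edge zero          (suc y)       6F ()
    outwardRed⇒edge zero          y             7F ()
    outwardRed⇒edge (suc zero)    y             7F ()

    edge⇒outwardRed : ∀ {k a b} → Edge a b → Displaced k a b → T (lookup (outwardRed (proj₁ a) (proj₂ a)) k)
    edge⇒outwardRed e ne-up    = diagonal-complete steep e
    edge⇒outwardRed e ne-right = diagonal-complete flat e
    edge⇒outwardRed e nw-up    = diagonal-complete steep (anti⇒diagonal steep e)
    edge⇒outwardRed e nw-left  = diagonal-complete flat (anti⇒diagonal flat e)
    edge⇒outwardRed e se-down  = diagonal-complete steep (anti⇒diagonal steep (edge-sym e))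
    edge⇒outwardRed e se-right = diagonal-complete flat (anti⇒diagonal flat (edge-sym e))
    edge⇒outwardRed e sw-down  = diagonal-complete steep (edge-sym e)
    edge⇒outwardRed e sw-left  = diagonal-complete flat (edge-sym e)

    outwardRed-count : (s : Square m n) → countᵇ id (outwardRed (toℕ (proj₁ s)) (toℕ (proj₂ s))) ≡ 2
    outwardRed-count s with degree2 G s
    ... | p , q , p≢q , sp , sq , only
      with direction (s , p , sp , refl , refl) | direction (s , q , sq , refl , refl)
    ... | kp , dp | kq , dq = begin
        countᵇ id bits
          ≡⟨ cong (countᵇ id) (sym (tabulate∘lookup bits)) ⟩
        countᵇ id (tabulate (lookup bits))
          ≡⟨ cong (countᵇ id) (tabulate-cong bit≡) ⟩
        countᵇ id (tabulate λ k → isYes (k Fin.≟ kp) ∨ isYes (k Fin.≟ kq))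
          ≡⟨ pair-count kp≢kq ⟩
        2 ∎
      where
      open ≡-Reasoning
      bits = outwardRed (toℕ (proj₁ s)) (toℕ (proj₂ s))

      kp≢kq : kp ≢ kq
      kp≢kq refl = p≢q (pos-injective (displaced-target-unique dp dq))

      bit⇒neighbour : ∀ k → T (lookup bits k) → k ≡ kp ⊎ k ≡ kq
      bit⇒neighbour k r with outwardRed⇒edge _ _ k r
      ... | _ , (s′ , t , e , ps′ , refl) , d with only t (subst (λ u → E G u t) (pos-injective ps′) e)
      ...   | inj₁ refl = inj₁ (displaced-direction-unique d dp)
      ...   | inj₂ refl = inj₂ (displaced-direction-unique d dq)

      neighbour⇒bit : ∀ k → k ≡ kp ⊎ k ≡ kq → T (lookup bits k)
      neighbour⇒bit k (inj₁ refl) = edge⇒outwardRed (s , p , sp , refl , refl) dp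
      neighbour⇒bit k (inj₂ refl) = edge⇒outwardRed (s , q , sq , refl , refl) dq

      bit≡ : ∀ k → lookup bits k ≡ isYes (k Fin.≟ kp) ∨ isYes (k Fin.≟ kq)
      bit≡ k = T-ext (Equivalence.from T-≟-pair ∘ bit⇒neighbour k) (neighbour⇒bit k ∘ Equivalence.to T-≟-pair)

    outwardRed-count-at : ∀ {x y} → x < m → y < n → countᵇ id (outwardRed x y) ≡ 2
    outwardRed-count-at x<m y<n = subst₂ (λ x y → countᵇ id (outwardRed x y) ≡ 2)
      (toℕ-fromℕ< x<m) (toℕ-fromℕ< y<n) (outwardRed-count (fromℕ< x<m , fromℕ< y<n))

    vertex-zero-or-two : ∀ a b → a ≤ m → b ≤ n → ZeroOrTwo (sideCount a b)
    vertex-zero-or-two zero          zero    _ _ = _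
    vertex-zero-or-two zero          (suc b) _ _ = _
    vertex-zero-or-two (suc zero)    zero    _ _ = _
    vertex-zero-or-two (suc (suc a)) zero    _ _ = _
    vertex-zero-or-two (suc a)       (suc b) a<m b<n =
      vertex-step (upRed (suc a) (suc b)) (downRed (suc a) (suc b)) (leftRed (suc a) (suc b)) (rightRed (suc a) (suc b))
                  (upRed a (suc b)) (downRed a (suc b)) (leftRed a (suc b))
                  (downRed (suc a) b) (leftRed (suc a) b) (rightRed (suc a) b)
                  (downRed a b) (leftRed a b)
        (outwardRed-count-at a<m b<n) upper-square
        (vertex-zero-or-two a (suc b) (<⇒≤ a<m) b<n)
        (vertex-zero-or-two (suc a) b a<m (<⇒≤ b<n))
        (vertex-zero-or-two a b (<⇒≤ a<m) (<⇒≤ b<n))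
      where
      upper-square : T (rightRed (suc a) (suc b)) → countᵇ id (lowerOutwardRed a (suc b)) ≤ 2
      upper-square r = ≤-trans (countᵇ-++ʳ (upperOutwardRed a (suc b)) (lowerOutwardRed a (suc b)))
        (≤-reflexive (outwardRed-count-at a<m (proj₂ (diagonal-bounds flat (diagonal-sound flat r)))))

    red⇒through : ∀ {v w : BVertex m n} → Red G v w → Through (bx v + bx w + 1) (by v + by w + 1)
    red⇒through (_ , s , t , _ , _ , (e , _) , cols , rows) = s , t , e , cols , rows

    through⇒red : ∀ {v w : BVertex m n} → BAdj v w → Through (bx v + bx w + 1) (by v + by w + 1) → Red G v w
    through⇒red adj (s , t , e , cols , rows) with crosspatch s t e
    ... | p′ , q′ , cross = adj , s , t , p′ , q′ , cross , cols , rows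

    red-sym : ∀ {v w : BVertex m n} → Red G v w → Red G w v
    red-sym {v} {w} (adj , s , t , p′ , q′ , cross , cols , rows) =
      adjacent-sym adj , s , t , p′ , q′ , cross ,
      trans cols (cong (_+ 1) (+-comm (bx v) (bx w))) , trans rows (cong (_+ 1) (+-comm (by v) (by w)))

    neighbour-red⇒side : ∀ {d} {v w : BVertex m n} → Neighbour d v w → Red G v w → T (redSides (bx v) (by v) d)
    neighbour-red⇒side {up} {v} (e , f) red =
      through⇒upRed (bx v) (by v) (through-subst e f (red⇒through red))
    neighbour-red⇒side {right} {v} (e , f) red =
      through⇒rightRed (bx v) (by v) (through-subst e f (red⇒through red))
    neighbour-red⇒side {down} nb@(e , f) red =
      subst₂ (λ a b → T (downRed a b)) (sym e) (sym f) (neighbour-red⇒side {up} nb (red-sym red))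
    neighbour-red⇒side {left} nb@(e , f) red =
      subst₂ (λ a b → T (leftRed a b)) (sym e) (sym f) (neighbour-red⇒side {right} nb (red-sym red))

    side⇒neighbour-red : ∀ {d} {v w : BVertex m n} → Neighbour d v w → T (redSides (bx v) (by v) d) → Red G v w
    side⇒neighbour-red {up} {v} nb@(e , f) r = through⇒red (neighbour⇒adjacent {d = up} nb)
      (through-subst (sym e) (sym f) (proj₁ (upRed⇒through (bx v) (by v) r)))
    side⇒neighbour-red {right} {v} nb@(e , f) r = through⇒red (neighbour⇒adjacent {d = right} nb)
      (through-subst (sym e) (sym f) (proj₁ (rightRed⇒through (bx v) (by v) r)))
    side⇒neighbour-red {down} nb@(e , f) r =
      red-sym (side⇒neighbour-red {up} nb (subst₂ (λ a b → T (downRed a b)) e f r))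
    side⇒neighbour-red {left} nb@(e , f) r =
      red-sym (side⇒neighbour-red {right} nb (subst₂ (λ a b → T (leftRed a b)) e f r))

    side-neighbour : ∀ d (v : BVertex m n) → T (redSides (bx v) (by v) d) → ∃[ w ] Neighbour d v w
    side-neighbour up v r = vertex-at (bx≤m v) (proj₂ (upRed⇒through (bx v) (by v) r))
    side-neighbour right v r = vertex-at (proj₂ (rightRed⇒through (bx v) (by v) r)) (by≤n v)
    side-neighbour down v r with downRed-positive (by v) r
    ... | b , eq with vertex-at (bx≤m v) (<⇒≤ (subst (_≤ n) eq (by≤n v)))
    ...   | w , e , f = w , sym e , trans eq (cong suc (sym f))
    side-neighbour left v r with leftRed-positive (bx v) r
    ... | a , eq with vertex-at (<⇒≤ (subst (_≤ m) eq (bx≤m v))) (by≤n v)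
    ...   | w , e , f = w , trans eq (cong suc (sym e)) , sym f

    red⇒side : ∀ {v w : BVertex m n} → Red G v w → ∃[ d ] (Neighbour d v w × T (redSides (bx v) (by v) d))
    red⇒side red with adjacent⇒neighbour (proj₁ red)
    ... | d , nb = d , nb , neighbour-red⇒side nb red

    side⇒red : ∀ d (v : BVertex m n) → T (redSides (bx v) (by v) d) → ∃[ w ] (Neighbour d v w × Red G v w)
    side⇒red d v r with side-neighbour d v r
    ... | w , nb = w , nb , side⇒neighbour-red nb r

    red-degree : (v : BVertex m n) → HDeg0 G v ⊎ HDeg2 G v
    red-degree v with zero-or-two-sides _ _ _ _ (vertex-zero-or-two (bx v) (by v) (bx≤m v) (by≤n v))
    ... | none no-side = inj₁ λ w red → let d , _ , r = red⇒side red in no-side d r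
    ... | two d₁ d₂ d₁≢d₂ r₁ r₂ only with side⇒red d₁ v r₁ | side⇒red d₂ v r₂
    ...   | w₁ , nb₁ , red₁ | w₂ , nb₂ , red₂ =
      inj₂ (w₁ , w₂ , w₁≢w₂ , red₁ , red₂ , only-w₁-w₂)
      where
      w₁≢w₂ : w₁ ≢ w₂
      w₁≢w₂ refl = d₁≢d₂ (neighbour-side-unique {d = d₁} {d₂} nb₁ nb₂)

      only-w₁-w₂ : ∀ w → Red G v w → w ≡ w₁ ⊎ w ≡ w₂
      only-w₁-w₂ w red with red⇒side red
      ... | d , nb , r with only d r
      ...   | inj₁ refl = inj₁ (neighbour-unique {d = d₁} nb nb₁)
      ...   | inj₂ refl = inj₂ (neighbour-unique {d = d₂} nb nb₂)

lemma2 : (m n : ℕ) → m ≥ 1 → n ≥ 1 → (G : Pseudotour m n) → Crosspatch G →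
    (v : BVertex m n) → HDeg0 G v ⊎ HDeg2 G v
lemma2 m n _ _ G crosspatch = Geometry.Crosspatched.red-degree G crosspatch
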